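{- Let $G$ be a finite, simple, undirected, connected graph with at least two vertices. Then $\gamma_t(G) = i_0(G) + 1$ if and only if $G$ has a dominating vertex, i.e. a vertex adjacent to every other vertex of $G$.
   Context: A set $S \subseteq V(G)$ is a total dominating set of $G$ if every vertex of $G$ (including those in $S$) has a neighbor in $S$; $\gamma_t(G)$ is the minimum cardinality of a total dominating set. A set $S \subseteq V(G)$ is an isolate set if the induced subgraph $G[S]$ has at least one isolated vertex (a vertex of degree $0$ in $G[S]$). An isolate set is maximal if no proper superset of it is an isolate set. The isolate number $i_0(G)$ is the minimum cardinality of a maximal isolate set of $G$. -}

module Defs where

open import Data.Nat using (ℕ; suc; _≤_; _<_)
open import Data.Fin using (Fin)
open import Data.Bool using (Bool; true; false)
open import Data.Fin.Subset using (Subset; _∈_; _∉_; _⊆_; _⊂_; ∣_∣)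
open import Data.Product using (Σ; ∃; ∃-syntax; _×_; _,_)
open import Relation.Binary.PropositionalEquality using (_≡_; _≢_)
open import Relation.Nullary using (¬_)

record Graph (n : ℕ) : Set where
  field
    adj   : Fin n → Fin n → Bool
    sym   : ∀ u v → adj u v ≡ adj v u
    irref : ∀ v → adj v v ≡ false

open Graph public

Adj : ∀ {n} → Graph n → Fin n → Fin n → Set
Adj G u v = adj G u v ≡ true

data Walk {n} (G : Graph n) : Fin n → Fin n → Set where
  here : ∀ {u} → Walk G u u
  step : ∀ {u w v} → Adj G u w → Walk G w v → Walk G u v

Connected : ∀ {n} → Graph n → Set
Connected G = ∀ u v → Walk G u v

IsTotalDominating : ∀ {n} → Graph n → Subset n → Set
IsTotalDominating G S = ∀ v → ∃[ u ] (u ∈ S × Adj G v u)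

IsTotalDominationNumber : ∀ {n} → Graph n → ℕ → Set
IsTotalDominationNumber G k =
  (∃[ S ] (IsTotalDominating G S × ∣ S ∣ ≡ k)) ×
  (∀ S → IsTotalDominating G S → k ≤ ∣ S ∣)

IsolatedIn : ∀ {n} → Graph n → Subset n → Fin n → Set
IsolatedIn G S v = v ∈ S × (∀ u → u ∈ S → ¬ Adj G v u)

IsIsolateSet : ∀ {n} → Graph n → Subset n → Set
IsIsolateSet G S = ∃[ v ] IsolatedIn G S v

IsMaximalIsolateSet : ∀ {n} → Graph n → Subset n → Set
IsMaximalIsolateSet G S =
  IsIsolateSet G S × (∀ T → S ⊂ T → ¬ IsIsolateSet G T)

IsIsolateNumber : ∀ {n} → Graph n → ℕ → Set
IsIsolateNumber G k =
  (∃[ S ] (IsMaximalIsolateSet G S × ∣ S ∣ ≡ k)) ×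
  (∀ S → IsMaximalIsolateSet G S → k ≤ ∣ S ∣)

IsDominatingVertex : ∀ {n} → Graph n → Fin n → Set
IsDominatingVertex G v = ∀ u → u ≢ v → Adj G v u

-- If v is a dominating vertex, then {v, u} is a total dominating set for any u ≠ v and
-- {v} is a maximal isolate set, so γt = 2 = i0 + 1.  Conversely, let S be a minimum maximal
-- isolate set with isolated vertex w, and suppose some a ≠ w is not adjacent to w.  The set T
-- of non-neighbours of w (w included) is an isolate set containing S, so T ⊆ S by maximality.
-- The walk from a to w leaves T ∖ {w} along an edge bc with c adjacent to w.  Then w, c and one
-- neighbour of each vertex of T ∖ {w, b} form a total dominating set of size at most |T| ≤ i0,
-- so γt ≤ i0.

module Submission where

open import Defs
open import Data.Nat using (ℕ; suc; _≤_; _+_)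
open import Data.Product using (∃-syntax; _×_)
open import Relation.Binary.PropositionalEquality using (_≡_)

open import Data.Nat using (_<_; z≤n; s≤s)
open import Data.Nat.Properties
  using (≤-trans; ≤-<-trans; ≤-reflexive; ≤-antisym; +-suc; +-monoʳ-≤; m+1+n≰m; module ≤-Reasoning)
open import Data.Bool using (true)
open import Data.Bool.Properties using () renaming (_≟_ to _≟ᵇ_)
open import Data.Fin using (Fin; zero; suc; _≟_; punchIn)
open import Data.Fin.Properties using (any?; punchInᵢ≢i)
open import Data.Fin.Subset using (Subset; inside; outside; _∈_; _⊆_; ∣_∣; ⊥; ⁅_⁆; _∪_; _-_; ∁)
open import Data.Fin.Subset.Properties
  using ( _∈?_; x∈⁅x⁆; x∈⁅y⁆⇒x≡y; x∉⁅y⁆⇒x≢y; ∣⁅x⁆∣≡1; ∣⊥∣≡0; ∣p∣≤∣x∷p∣; p⊆q⇒∣p∣≤∣q∣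
        ; x∈p∪q⁺; x∈p∧x≢y⇒x∈p-y; x∈p⇒∣p-x∣<∣p∣; x∈∁p⇒x∉p; x∉p⇒x∈∁p)
open import Data.Vec using ([]; _∷_; here; there; tabulate)
open import Data.Vec.Properties using (lookup∘tabulate; lookup⇒[]=; []=⇒lookup)
open import Data.Product using (∃; ∃₂; _,_)
open import Data.Sum using (_⊎_; inj₁; inj₂)
open import Function using (_∘_)
open import Relation.Nullary using (¬_; Dec; yes; no; contradiction)
open import Relation.Nullary.Decidable using (_×-dec_; ¬?; decidable-stable)
open import Relation.Unary using (Pred; Decidable)
open import Relation.Binary.PropositionalEquality as ≡ using (_≢_; refl; trans; cong; subst)

private
  variable
    m n : ℕ
    p : Subset n
    x y : Fin n

x∈p⇒0<∣p∣ : x ∈ p → 0 < ∣ p ∣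
x∈p⇒0<∣p∣ x∈p = ≤-<-trans z≤n (x∈p⇒∣p-x∣<∣p∣ x∈p)

x∈p∧y∈p∧x≢y⇒1<∣p∣ : x ∈ p → y ∈ p → x ≢ y → 1 < ∣ p ∣
x∈p∧y∈p∧x≢y⇒1<∣p∣ x∈p y∈p x≢y =
  ≤-<-trans (x∈p⇒0<∣p∣ (x∈p∧x≢y⇒x∈p-y y∈p (x≢y ∘ ≡.sym))) (x∈p⇒∣p-x∣<∣p∣ x∈p)

∣p∪q∣≤∣p∣+∣q∣ : (p q : Subset n) → ∣ p ∪ q ∣ ≤ ∣ p ∣ + ∣ q ∣
∣p∪q∣≤∣p∣+∣q∣ []            []            = z≤n
∣p∪q∣≤∣p∣+∣q∣ (inside  ∷ p) (s ∷ q)       =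
  s≤s (≤-trans (∣p∪q∣≤∣p∣+∣q∣ p q) (+-monoʳ-≤ ∣ p ∣ (∣p∣≤∣x∷p∣ s q)))
∣p∪q∣≤∣p∣+∣q∣ (outside ∷ p) (inside  ∷ q) =
  ≤-trans (s≤s (∣p∪q∣≤∣p∣+∣q∣ p q)) (≤-reflexive (≡.sym (+-suc ∣ p ∣ ∣ q ∣)))
∣p∪q∣≤∣p∣+∣q∣ (outside ∷ p) (outside ∷ q) = ∣p∪q∣≤∣p∣+∣q∣ p q

∣⁅x⁆∪p∣≤1+∣p∣ : (x : Fin n) (p : Subset n) → ∣ ⁅ x ⁆ ∪ p ∣ ≤ 1 + ∣ p ∣
∣⁅x⁆∪p∣≤1+∣p∣ x p = subst (λ k → ∣ ⁅ x ⁆ ∪ p ∣ ≤ k + ∣ p ∣) (∣⁅x⁆∣≡1 x) (∣p∪q∣≤∣p∣+∣q∣ ⁅ x ⁆ p)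

image : (Fin m → Fin n) → Subset m → Subset n
image f []            = ⊥
image f (outside ∷ p) = image (f ∘ suc) p
image f (inside  ∷ p) = ⁅ f zero ⁆ ∪ image (f ∘ suc) p

∈-image⁺ : (f : Fin m → Fin n) → x ∈ p → f x ∈ image f p
∈-image⁺ {p = inside  ∷ p} f here        = x∈p∪q⁺ (inj₁ (x∈⁅x⁆ (f zero)))
∈-image⁺ {p = inside  ∷ p} f (there x∈p) = x∈p∪q⁺ (inj₂ (∈-image⁺ (f ∘ suc) x∈p))
∈-image⁺ {p = outside ∷ p} f (there x∈p) = ∈-image⁺ (f ∘ suc) x∈p

∣image∣≤∣p∣ : (f : Fin m → Fin n) (p : Subset m) → ∣ image f p ∣ ≤ ∣ p ∣
∣image∣≤∣p∣ {n = n} f []            = ≤-reflexive (∣⊥∣≡0 n)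
∣image∣≤∣p∣ f (outside ∷ p) = ∣image∣≤∣p∣ (f ∘ suc) p
∣image∣≤∣p∣ f (inside  ∷ p) =
  ≤-trans (∣⁅x⁆∪p∣≤1+∣p∣ (f zero) (image (f ∘ suc) p)) (s≤s (∣image∣≤∣p∣ (f ∘ suc) p))

anotherVertex : 2 ≤ n → (v : Fin n) → ∃[ u ] u ≢ v
anotherVertex (s≤s (s≤s _)) v = punchIn v zero , punchInᵢ≢i v zero

module _ (G : Graph n) where

  adj? : (u v : Fin n) → Dec (Adj G u v)
  adj? u v = adj G u v ≟ᵇ true

  Adj-sym : ∀ {u v} → Adj G u v → Adj G v u
  Adj-sym {u} {v} = trans (sym G v u)

  Adj-irrefl : ∀ {v} → ¬ Adj G v v
  Adj-irrefl {v} v~v = contradiction (trans (≡.sym (irref G v)) v~v) λ ()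

  Adj⇒≢ : ∀ {u v} → Adj G u v → u ≢ v
  Adj⇒≢ u~u refl = Adj-irrefl u~u

  neighbourhood : Fin n → Subset n
  neighbourhood w = tabulate (adj G w)

  nonNeighbours : Fin n → Subset n
  nonNeighbours w = ∁ (neighbourhood w)

  ∈-nonNeighbours⁺ : ∀ {w x} → ¬ Adj G w x → x ∈ nonNeighbours w
  ∈-nonNeighbours⁺ {w} {x} ¬w~x = x∉p⇒x∈∁p λ x∈N →
    ¬w~x (trans (≡.sym (lookup∘tabulate (adj G w) x)) ([]=⇒lookup x∈N))

  ∈-nonNeighbours⁻ : ∀ {w x} → x ∈ nonNeighbours w → ¬ Adj G w x
  ∈-nonNeighbours⁻ {w} {x} x∈T w~x =
    x∈∁p⇒x∉p x∈T (lookup⇒[]= x _ (trans (lookup∘tabulate (adj G w) x) w~x))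

  Far : Fin n → Pred (Fin n) _
  Far w x = x ≢ w × ¬ Adj G w x

  far? : (w : Fin n) → Decidable (Far w)
  far? w x = ¬? (x ≟ w) ×-dec ¬? (adj? w x)

  dominating⊎far : (w : Fin n) → IsDominatingVertex G w ⊎ ∃ (Far w)
  dominating⊎far w with any? (far? w)
  ... | yes far = inj₂ far
  ... | no ¬far = inj₁ λ u u≢w → decidable-stable (adj? w u) (λ ¬w~u → ¬far (u , u≢w , ¬w~u))

  walk-exits : ∀ {ℓ} {P : Pred (Fin n) ℓ} → Decidable P → ∀ {a v} →
               Walk G a v → P a → ¬ P v → ∃₂ λ b c → P b × ¬ P c × Adj G b c
  walk-exits P? here                    Pa ¬Pv = contradiction Pa ¬Pv
  walk-exits P? (step {w = x} a~x walk) Pa ¬Pv with P? x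
  ... | yes Px = walk-exits P? walk Px ¬Pv
  ... | no ¬Px = _ , x , Pa , ¬Px , a~x

  firstStep : ∀ {x v} → Walk G x v → Fin n
  firstStep {x} here           = x
  firstStep (step {w = y} _ _) = y

  Adj-firstStep : ∀ {x v} → x ≢ v → (walk : Walk G x v) → Adj G x (firstStep walk)
  Adj-firstStep x≢x here         = contradiction refl x≢x
  Adj-firstStep _   (step x~y _) = x~y

  far⇒bridge : Connected G → ∀ {w a} → Far w a → ∃₂ λ b c → Far w b × Adj G b c × Adj G w c
  far⇒bridge connected {w} {a} far-a
    with walk-exits (far? w) (connected a w) far-a (λ (w≢w , _) → w≢w refl)
  ... | b , c , far-b@(_ , ¬w~b) , ¬far-c , b~c =
    b , c , far-b , b~c , decidable-stable (adj? w c) (λ ¬w~c → ¬far-c (c≢w , ¬w~c))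
    where
    c≢w : c ≢ w
    c≢w refl = ¬w~b (Adj-sym b~c)

  far⇒smallTotalDominatingSet : Connected G → ∀ {w a} → Far w a →
    ∃[ D ] (IsTotalDominating G D × ∣ D ∣ ≤ ∣ nonNeighbours w ∣)
  far⇒smallTotalDominatingSet connected {w} far-a
    with far⇒bridge connected far-a
  ... | b , c , (b≢w , ¬w~b) , b~c , w~c = D , dominates , size
    where
    towardsW : Fin n → Fin n
    towardsW x = firstStep (connected x w)

    T R D : Subset n
    T = nonNeighbours w
    R = T - w - b
    D = ⁅ w ⁆ ∪ ⁅ c ⁆ ∪ image towardsW R

    w∈T : w ∈ T
    w∈T = ∈-nonNeighbours⁺ Adj-irrefl
    b∈T-w : b ∈ T - w
    b∈T-w = x∈p∧x≢y⇒x∈p-y (∈-nonNeighbours⁺ ¬w~b) b≢w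

    dominates : IsTotalDominating G D
    dominates y with adj? w y | y ≟ w | y ≟ b
    ... | yes w~y | _        | _        = w , x∈p∪q⁺ (inj₁ (x∈⁅x⁆ w)) , Adj-sym w~y
    ... | no _    | yes refl | _        = c , x∈p∪q⁺ (inj₂ (x∈p∪q⁺ (inj₁ (x∈⁅x⁆ c)))) , w~c
    ... | no _    | no _     | yes refl = c , x∈p∪q⁺ (inj₂ (x∈p∪q⁺ (inj₁ (x∈⁅x⁆ c)))) , b~c
    ... | no ¬w~y | no y≢w   | no y≢b   =
      towardsW y , x∈p∪q⁺ (inj₂ (x∈p∪q⁺ (inj₂ (∈-image⁺ towardsW y∈R)))) ,
      Adj-firstStep y≢w (connected y w)
      where
      y∈R : y ∈ R
      y∈R = x∈p∧x≢y⇒x∈p-y (x∈p∧x≢y⇒x∈p-y (∈-nonNeighbours⁺ ¬w~y) y≢w) y≢b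

    size : ∣ D ∣ ≤ ∣ T ∣
    size = begin
      ∣ D ∣                             ≤⟨ ∣⁅x⁆∪p∣≤1+∣p∣ w _ ⟩
      1 + ∣ ⁅ c ⁆ ∪ image towardsW R ∣ ≤⟨ s≤s (∣⁅x⁆∪p∣≤1+∣p∣ c _) ⟩
      2 + ∣ image towardsW R ∣          ≤⟨ s≤s (s≤s (∣image∣≤∣p∣ towardsW R)) ⟩
      2 + ∣ R ∣                         ≤⟨ s≤s (x∈p⇒∣p-x∣<∣p∣ b∈T-w) ⟩
      1 + ∣ T - w ∣                     ≤⟨ x∈p⇒∣p-x∣<∣p∣ w∈T ⟩
      ∣ T ∣                             ∎
      where open ≤-Reasoning

  maximal⇒isolateSuperset⊆ : ∀ {S T} → IsMaximalIsolateSet G S → S ⊆ T → IsIsolateSet G T → T ⊆ S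
  maximal⇒isolateSuperset⊆ {S} {T} (_ , maximal) S⊆T T-isolate {x} x∈T with x ∈? S
  ... | yes x∈S = x∈S
  ... | no x∉S  = contradiction T-isolate (maximal T (S⊆T , x , x∈T , x∉S))

  maximal⇒nonNeighbours⊆ : ∀ {S w} → IsMaximalIsolateSet G S → IsolatedIn G S w → nonNeighbours w ⊆ S
  maximal⇒nonNeighbours⊆ {w = w} S-maximal (_ , w-isolated) =
    maximal⇒isolateSuperset⊆ S-maximal
      (λ {x} x∈S → ∈-nonNeighbours⁺ (w-isolated x x∈S))
      (w , ∈-nonNeighbours⁺ Adj-irrefl , λ u → ∈-nonNeighbours⁻)

  dominatingVertex⊎γt≤i0 : Connected G → ∀ {γt i0} → IsTotalDominationNumber G γt → IsIsolateNumber G i0 →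
                           ∃ (IsDominatingVertex G) ⊎ γt ≤ i0
  dominatingVertex⊎γt≤i0 connected {γt} {i0} (_ , γt-min)
    ((S , S-maximal@((w , w-isolated) , _) , ∣S∣≡i0) , _) with dominating⊎far w
  ... | inj₁ w-dominating = inj₁ (w , w-dominating)
  ... | inj₂ (_ , far-a) with far⇒smallTotalDominatingSet connected far-a
  ...   | D , D-dominating , ∣D∣≤∣T∣ = inj₂ (begin
    γt                    ≤⟨ γt-min D D-dominating ⟩
    ∣ D ∣                 ≤⟨ ∣D∣≤∣T∣ ⟩
    ∣ nonNeighbours w ∣   ≤⟨ p⊆q⇒∣p∣≤∣q∣ (maximal⇒nonNeighbours⊆ S-maximal w-isolated) ⟩
    ∣ S ∣                 ≡⟨ ∣S∣≡i0 ⟩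
    i0                    ∎)
    where open ≤-Reasoning

  totalDominating⇒1<∣S∣ : ∀ {S} → Fin n → IsTotalDominating G S → 1 < ∣ S ∣
  totalDominating⇒1<∣S∣ v S-dominating =
    let u , u∈S , _    = S-dominating v
        x , x∈S , u~x  = S-dominating u
    in  x∈p∧y∈p∧x≢y⇒1<∣p∣ u∈S x∈S (Adj⇒≢ u~x)

  dominatingVertex⇒totalDominatingPair : ∀ {u v} → IsDominatingVertex G v → u ≢ v →
                                          IsTotalDominating G (⁅ v ⁆ ∪ ⁅ u ⁆)
  dominatingVertex⇒totalDominatingPair {u} {v} v-dominating u≢v y with y ≟ v
  ... | yes refl = u , x∈p∪q⁺ (inj₂ (x∈⁅x⁆ u)) , v-dominating u u≢v
  ... | no y≢v   = v , x∈p∪q⁺ (inj₁ (x∈⁅x⁆ v)) , Adj-sym (v-dominating y y≢v)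

  dominatingVertex⇒¬isolateSet : ∀ {T v z} → IsDominatingVertex G v → v ∈ T → z ∈ T → z ≢ v →
                                  ¬ IsIsolateSet G T
  dominatingVertex⇒¬isolateSet {v = v} v-dominating v∈T z∈T z≢v (x , _ , x-isolated) with x ≟ v
  ... | yes refl = x-isolated _ z∈T (v-dominating _ z≢v)
  ... | no x≢v   = x-isolated v v∈T (Adj-sym (v-dominating x x≢v))

  dominatingVertex⇒maximalIsolate⁅v⁆ : ∀ {v} → IsDominatingVertex G v → IsMaximalIsolateSet G ⁅ v ⁆
  dominatingVertex⇒maximalIsolate⁅v⁆ {v} v-dominating =
    (v , x∈⁅x⁆ v , λ u u∈⁅v⁆ → subst (¬_ ∘ Adj G v) (≡.sym (x∈⁅y⁆⇒x≡y v u∈⁅v⁆)) Adj-irrefl) ,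
    λ T (⁅v⁆⊆T , z , z∈T , z∉⁅v⁆) →
      dominatingVertex⇒¬isolateSet v-dominating (⁅v⁆⊆T (x∈⁅x⁆ v)) z∈T (x∉⁅y⁆⇒x≢y z∉⁅v⁆)

  dominatingVertex⇒γt≡2 : 2 ≤ n → ∀ {γt} → IsTotalDominationNumber G γt →
                          ∃ (IsDominatingVertex G) → γt ≡ 2
  dominatingVertex⇒γt≡2 2≤n ((S , S-dominating , ∣S∣≡γt) , γt-min) (v , v-dominating) =
    let u , u≢v = anotherVertex 2≤n v
    in  ≤-antisym
          (≤-trans (γt-min _ (dominatingVertex⇒totalDominatingPair v-dominating u≢v))
                   (≤-trans (∣⁅x⁆∪p∣≤1+∣p∣ v ⁅ u ⁆) (s≤s (≤-reflexive (∣⁅x⁆∣≡1 u)))))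
          (subst (1 <_) ∣S∣≡γt (totalDominating⇒1<∣S∣ v S-dominating))

  dominatingVertex⇒i0≡1 : ∀ {i0} → IsIsolateNumber G i0 → ∃ (IsDominatingVertex G) → i0 ≡ 1
  dominatingVertex⇒i0≡1 ((S , ((x , x∈S , _) , _) , ∣S∣≡i0) , i0-min) (v , v-dominating) =
    ≤-antisym
      (subst (_ ≤_) (∣⁅x⁆∣≡1 v) (i0-min ⁅ v ⁆ (dominatingVertex⇒maximalIsolate⁅v⁆ v-dominating)))
      (subst (0 <_) ∣S∣≡i0 (x∈p⇒0<∣p∣ x∈S))

corollary2p5 : ∀ {n} (G : Graph n) → 2 ≤ n → Connected G →
    ∀ (γt i0 : ℕ) → IsTotalDominationNumber G γt → IsIsolateNumber G i0 →
    ((γt ≡ i0 + 1 → ∃[ v ] IsDominatingVertex G v) ×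
     (∃[ v ] IsDominatingVertex G v → γt ≡ i0 + 1))
corollary2p5 G 2≤n connected γt i0 γt-is i0-is = forward , backward
  where
  forward : γt ≡ i0 + 1 → ∃[ v ] IsDominatingVertex G v
  forward γt≡i0+1 with dominatingVertex⊎γt≤i0 G connected γt-is i0-is
  ... | inj₁ dominating = dominating
  ... | inj₂ γt≤i0      = contradiction (subst (_≤ i0) γt≡i0+1 γt≤i0) (m+1+n≰m i0)

  backward : ∃[ v ] IsDominatingVertex G v → γt ≡ i0 + 1
  backward dominating =
    trans (dominatingVertex⇒γt≡2 G 2≤n γt-is dominating)
          (cong (_+ 1) (≡.sym (dominatingVertex⇒i0≡1 G i0-is dominating)))
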